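{- Fix $k\in\mathbb{N}$ and let $a_n=\left\lceil \frac{2^{n+k-1}}{2^k+1}\right\rceil$ for $n\ge 1$. Then the sequence $(\Gamma(a_n,a_{n+1}))_{n\ge1}$ is $$\underbrace{1,\ldots,1}_{k},\underbrace{2,\ldots,2}_{k},\underbrace{1,\ldots,1}_{k},\underbrace{2,\ldots,2}_{k},\ldots,$$ i.e., $\Gamma(a_n,a_{n+1})=1$ if $n\equiv 1,\ldots,k \pmod{2k}$ and $\Gamma(a_n,a_{n+1})=2$ if $n\equiv k+1,\ldots,2k\pmod{2k}$.
   Context: $\mathbb{N}$ denotes the positive integers. For coprime $a,b\in\mathbb{N}$, consider the equations (E1) $ax+by=\frac{(a-1)(b-1)}{2}$ and (E2) $ax+by+1=\frac{(a-1)(b-1)}{2}$. We say the pair $(a,b)$ uses (E1) if (E1) has a solution in nonnegative integers $x,y$. For arbitrary $a,b\in\mathbb{N}$ with $d=\gcd(a,b)$, define $\Gamma(a,b)=1$ if the coprime pair $(a/d,b/d)$ uses (E1), and $\Gamma(a,b)=2$ otherwise. -}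

module Defs where

open import Data.Nat using (ℕ; zero; suc; _+_; _*_; _∸_; _^_; _/_; _%_; _≤_; NonZero)
open import Data.Nat.GCD using (gcd)
open import Data.Product using (∃₂; _×_)
open import Relation.Binary.PropositionalEquality using (_≡_)
open import Relation.Nullary using (¬_)

⌈_/_⌉ : ℕ → (d : ℕ) → .{{NonZero d}} → ℕ
⌈ m / d ⌉ = (m + d ∸ 1) / d

-- The pair (a , b) "uses (E1)": a x + b y = (a-1)(b-1)/2 has a solution in
-- nonnegative integers. (Used only for coprime pairs, for which (a-1)(b-1)
-- is even, so natural-number halving is exact.)
UsesE1 : ℕ → ℕ → Set
UsesE1 a b = ∃₂ λ (x y : ℕ) → a * x + b * y ≡ ((a ∸ 1) * (b ∸ 1)) / 2

-- Γ a b v  means  Γ(a,b) = v.  With d = gcd a b, a' = a/d, b' = b/d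
-- (expressed as a' * d ≡ a, b' * d ≡ b):
-- Γ(a,b) = 1 iff (a',b') uses (E1), Γ(a,b) = 2 iff it does not.
data Γ (a b : ℕ) : ℕ → Set where
  Γ-one : ∀ a' b' → a' * gcd a b ≡ a → b' * gcd a b ≡ b → UsesE1 a' b' → Γ a b 1
  Γ-two : ∀ a' b' → a' * gcd a b ≡ a → b' * gcd a b ≡ b → ¬ UsesE1 a' b' → Γ a b 2

seqA : ℕ → ℕ → ℕ
seqA k n = ⌈ 2 ^ (n + k ∸ 1) / (1 + 2 ^ k) ⌉

{-# OPTIONS --safe #-}
-- Put X = 2 ^ k, so X ≡ -1 and X * X ≡ 1 modulo 1 + X.  With e = n + k - 1:
-- if n ≡ 1 + s (mod 2k) with s < k, then 2 ^ e ≡ -2 ^ s, the ceiling rounds 2 ^ e up by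
-- 2 ^ s and 2 ^ (1 + e) up by 2 ^ (1 + s), so a_(n+1) = 2 a_n and Γ = Γ(1,2) = 1.
-- If n ≡ k + 1 + j (mod 2k) with j < k, then 2 ^ e ≡ 2 ^ j, so a_n = 1 + p and
-- a_(n+1) = 1 + 2p with p ≥ 1; that pair is coprime and p * p is not of the form
-- (1 + p) x + (1 + 2p) y, hence Γ = 2.
module Submission where

open import Defs
open import Data.Nat using (ℕ; zero; suc; _+_; _*_; _∸_; _^_; _/_; _≤_; _<_; z≤n; s≤s; s≤s⁻¹; z<s; NonZero; >-nonZero)
open import Data.Nat.Properties
open import Data.Nat.DivMod using (+-distrib-/-∣ˡ; m*n/n≡m; m<n⇒m/n≡0)
open import Data.Nat.Divisibility
open import Data.Nat.GCD using (gcd; gcd[m,n]∣m; gcd[m,n]∣n; gcd-greatest)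
open import Data.Nat.Tactic.RingSolver using (solve)
open import Data.List.Base using ([]; _∷_)
open import Data.Product using (_×_; _,_; ∃)
open import Data.Empty using (⊥-elim)
open import Relation.Binary.PropositionalEquality

[m*n+o]/n≡m : ∀ m {n o} .{{_ : NonZero n}} → o < n → (m * n + o) / n ≡ m
[m*n+o]/n≡m m {n} {o} o<n = begin
  (m * n + o) / n    ≡⟨ +-distrib-/-∣ˡ o (divides-refl m) ⟩
  m * n / n + o / n  ≡⟨ cong₂ _+_ (m*n/n≡m m n) (m<n⇒m/n≡0 o<n) ⟩
  m + 0              ≡⟨ +-identityʳ m ⟩
  m                  ∎
  where open ≡-Reasoning

m+w≡q*d⇒⌈m/d⌉≡q : ∀ {m w q d} .{{_ : NonZero d}} → m + w ≡ q * d → w < d → ⌈ m / d ⌉ ≡ q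
m+w≡q*d⇒⌈m/d⌉≡q {m} {w} {q} {suc d} m+w≡q*d (s≤s w≤d) = begin
  ⌈ m / suc d ⌉                         ≡⟨⟩
  (m + suc d ∸ 1) / suc d               ≡⟨ cong (λ x → (x ∸ 1) / suc d) (+-suc m d) ⟩
  (m + d) / suc d                       ≡⟨ cong (λ x → (m + x) / suc d) (sym (m+[n∸m]≡n w≤d)) ⟩
  (m + (w + (d ∸ w))) / suc d           ≡⟨ cong (_/ suc d) (sym (+-assoc m w (d ∸ w))) ⟩
  (m + w + (d ∸ w)) / suc d             ≡⟨ cong (λ x → (x + (d ∸ w)) / suc d) m+w≡q*d ⟩
  (q * suc d + (d ∸ w)) / suc d         ≡⟨ [m*n+o]/n≡m q (s≤s (m∸n≤m d w)) ⟩
  q                                     ∎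
  where open ≡-Reasoning

m≡q*d+w⇒⌈m/d⌉≡1+q : ∀ {m w q d} .{{_ : NonZero d}} → m ≡ q * d + w → 0 < w → w ≤ d →
                     ⌈ m / d ⌉ ≡ suc q
m≡q*d+w⇒⌈m/d⌉≡1+q {m} {w} {q} {d} refl 0<w w≤d =
  m+w≡q*d⇒⌈m/d⌉≡q m+[d∸w]≡[1+q]*d (∸-monoʳ-< 0<w w≤d)
  where
  open ≡-Reasoning
  m+[d∸w]≡[1+q]*d : q * d + w + (d ∸ w) ≡ suc q * d
  m+[d∸w]≡[1+q]*d = begin
    q * d + w + (d ∸ w)    ≡⟨ +-assoc (q * d) w (d ∸ w) ⟩
    q * d + (w + (d ∸ w))  ≡⟨ cong (q * d +_) (m+[n∸m]≡n w≤d) ⟩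
    q * d + d              ≡⟨ +-comm (q * d) d ⟩
    suc q * d              ∎

gcd[q,2q]≡q : ∀ q → gcd q (2 * q) ≡ q
gcd[q,2q]≡q q = ∣-antisym (gcd[m,n]∣m q (2 * q)) (gcd-greatest ∣-refl (n∣m*n 2))

Γ[q,2q]≡1 : ∀ q → Γ q (2 * q) 1
Γ[q,2q]≡1 q = Γ-one 1 2 (trans (*-identityˡ _) (gcd[q,2q]≡q q)) (cong (2 *_) (gcd[q,2q]≡q q))
  (0 , 0 , refl)

gcd[1+p,1+2p]≡1 : ∀ p → gcd (suc p) (suc (2 * p)) ≡ 1
gcd[1+p,1+2p]≡1 p = ∣1⇒≡1 (∣m+n∣m⇒∣n g∣[1+2p]+1 (gcd[m,n]∣n (suc p) (suc (2 * p))))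
  where
  2[1+p]≡[1+2p]+1 : 2 * suc p ≡ suc (2 * p) + 1
  2[1+p]≡[1+2p]+1 = solve (p ∷ [])
  g∣[1+2p]+1 : gcd (suc p) (suc (2 * p)) ∣ suc (2 * p) + 1
  g∣[1+2p]+1 = subst (gcd (suc p) (suc (2 * p)) ∣_) 2[1+p]≡[1+2p]+1
                 (∣n⇒∣m*n 2 (gcd[m,n]∣m (suc p) (suc (2 * p))))

-- Modulo 1 + p the left side is ≡ -y and the right side ≡ 1, forcing y ≥ p,
-- which already makes the left side too large.
[1+p]x+[1+2p]y≢p*p : ∀ p x y → 1 ≤ p → suc p * x + suc (2 * p) * y ≢ p * p
[1+p]x+[1+2p]y≢p*p p@(suc c) x y _ eq =
  <⇒≢ (<-≤-trans p*p<[1+2p]y ([1+2p]y≤lhs)) (sym eq)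
  where
  open ≡-Reasoning
  [x+2y][1+p]≡c[1+p]+[1+y] : (x + 2 * y) * suc p ≡ c * suc p + suc y
  [x+2y][1+p]≡c[1+p]+[1+y] = begin
    (x + 2 * y) * suc p                       ≡⟨ solve (c ∷ x ∷ y ∷ []) ⟩
    suc p * x + suc (2 * p) * y + y           ≡⟨ cong (_+ y) eq ⟩
    p * p + y                                 ≡⟨ solve (c ∷ y ∷ []) ⟩
    c * suc p + suc y                         ∎
  p≤y : p ≤ y
  p≤y = s≤s⁻¹ (∣⇒≤ (∣m+n∣m⇒∣n (divides (x + 2 * y) (sym [x+2y][1+p]≡c[1+p]+[1+y]))
                                 (n∣m*n c)))
  p*p<[1+2p]y : p * p < suc (2 * p) * y
  p*p<[1+2p]y = <-≤-trans (*-monoˡ-< p (s≤s (m≤n*m p 2))) (*-monoʳ-≤ (suc (2 * p)) p≤y)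
  [1+2p]y≤lhs : suc (2 * p) * y ≤ suc p * x + suc (2 * p) * y
  [1+2p]y≤lhs = m≤n+m (suc (2 * p) * y) (suc p * x)

Γ[1+p,1+2p]≡2 : ∀ p → 1 ≤ p → Γ (suc p) (suc (2 * p)) 2
Γ[1+p,1+2p]≡2 p 1≤p = Γ-two (suc p) (suc (2 * p))
  (trans (cong (suc p *_) (gcd[1+p,1+2p]≡1 p)) (*-identityʳ _))
  (trans (cong (suc (2 * p) *_) (gcd[1+p,1+2p]≡1 p)) (*-identityʳ _))
  λ { (x , y , eq) → [1+p]x+[1+2p]y≢p*p p x y 1≤p (trans eq p[2p]/2≡p*p) }
  where
  p[2p]≡p*p*2 : p * (2 * p) ≡ p * p * 2
  p[2p]≡p*p*2 = solve (p ∷ [])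
  p[2p]/2≡p*p : p * (2 * p) / 2 ≡ p * p
  p[2p]/2≡p*p = trans (cong (_/ 2) p[2p]≡p*p*2) (m*n/n≡m (p * p) 2)

Γ⌈m/d⌉⌈2m/d⌉≡1 : ∀ {m w d} .{{_ : NonZero d}} → d ∣ m + w → 2 * w < d →
                 Γ ⌈ m / d ⌉ ⌈ 2 * m / d ⌉ 1
Γ⌈m/d⌉⌈2m/d⌉≡1 {m} {w} {d} (divides q m+w≡q*d) 2w<d =
  subst₂ (λ a b → Γ a b 1) (sym ⌈m/d⌉≡q) (sym ⌈2m/d⌉≡2q) (Γ[q,2q]≡1 q)
  where
  open ≡-Reasoning
  2m+2w≡2q*d : 2 * m + 2 * w ≡ 2 * q * d
  2m+2w≡2q*d = begin
    2 * m + 2 * w    ≡⟨ *-distribˡ-+ 2 m w ⟨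
    2 * (m + w)      ≡⟨ cong (2 *_) m+w≡q*d ⟩
    2 * (q * d)      ≡⟨ *-assoc 2 q d ⟨
    2 * q * d        ∎
  ⌈m/d⌉≡q : ⌈ m / d ⌉ ≡ q
  ⌈m/d⌉≡q = m+w≡q*d⇒⌈m/d⌉≡q m+w≡q*d (≤-<-trans (m≤n*m w 2) 2w<d)
  ⌈2m/d⌉≡2q : ⌈ 2 * m / d ⌉ ≡ 2 * q
  ⌈2m/d⌉≡2q = m+w≡q*d⇒⌈m/d⌉≡q {2 * m} 2m+2w≡2q*d 2w<d

Γ⌈m/d⌉⌈2m/d⌉≡2 : ∀ {m p w d} .{{_ : NonZero d}} → m ≡ p * d + w → 1 ≤ p → 0 < w → 2 * w ≤ d →
                 Γ ⌈ m / d ⌉ ⌈ 2 * m / d ⌉ 2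
Γ⌈m/d⌉⌈2m/d⌉≡2 {m} {p} {w} {d} m≡p*d+w 1≤p 0<w 2w≤d =
  subst₂ (λ a b → Γ a b 2) (sym ⌈m/d⌉≡1+p) (sym ⌈2m/d⌉≡1+2p) (Γ[1+p,1+2p]≡2 p 1≤p)
  where
  open ≡-Reasoning
  2m≡2p*d+2w : 2 * m ≡ 2 * p * d + 2 * w
  2m≡2p*d+2w = begin
    2 * m                ≡⟨ cong (2 *_) m≡p*d+w ⟩
    2 * (p * d + w)      ≡⟨ *-distribˡ-+ 2 (p * d) w ⟩
    2 * (p * d) + 2 * w  ≡⟨ cong (_+ 2 * w) (*-assoc 2 p d) ⟨
    2 * p * d + 2 * w    ∎
  ⌈m/d⌉≡1+p : ⌈ m / d ⌉ ≡ suc p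
  ⌈m/d⌉≡1+p = m≡q*d+w⇒⌈m/d⌉≡1+q m≡p*d+w 0<w (≤-trans (m≤n*m w 2) 2w≤d)
  ⌈2m/d⌉≡1+2p : ⌈ 2 * m / d ⌉ ≡ suc (2 * p)
  ⌈2m/d⌉≡1+2p = m≡q*d+w⇒⌈m/d⌉≡1+q {2 * m} 2m≡2p*d+2w (≤-trans 0<w (m≤n*m w 2)) 2w≤d

[X*X]^t≡1[mod1+X] : ∀ {X} t → 1 ≤ X → ∃ λ P → (X * X) ^ t ≡ P * suc X + 1
[X*X]^t≡1[mod1+X] zero _ = 0 , refl
[X*X]^t≡1[mod1+X] {X@(suc Y)} (suc t) 1≤X with [X*X]^t≡1[mod1+X] t 1≤X
... | P , eq = X * X * P + Y , (begin
  X * X * (X * X) ^ t          ≡⟨ cong (X * X *_) eq ⟩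
  X * X * (P * suc X + 1)      ≡⟨ solve (Y ∷ P ∷ []) ⟩
  (X * X * P + Y) * suc X + 1  ∎)
  where open ≡-Reasoning

[X*X]^[1+t]≡[1+P][1+X]+1 : ∀ {X} t → 1 < X → ∃ λ P → (X * X) ^ suc t ≡ suc P * suc X + 1
[X*X]^[1+t]≡[1+P][1+X]+1 {X} t 1<X with [X*X]^t≡1[mod1+X] (suc t) (<⇒≤ 1<X)
... | suc P , eq = P , eq
... | zero  , eq = ⊥-elim (<-irrefl (sym eq) 1<[X*X]^[1+t])
  where
  1<X*X : 1 < X * X
  1<X*X = <-≤-trans 1<X (m≤m*n X X {{>-nonZero (<⇒≤ 1<X)}})
  1<[X*X]^[1+t] : 1 < (X * X) ^ suc t
  1<[X*X]^[1+t] = ^-monoʳ-< (X * X) 1<X*X {0} {suc t} z<s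

1+X∣X*[X*X]^t+1 : ∀ {X} t → 1 ≤ X → suc X ∣ X * (X * X) ^ t + 1
1+X∣X*[X*X]^t+1 {X} t 1≤X with [X*X]^t≡1[mod1+X] t 1≤X
... | P , eq = divides (X * P + 1) (begin
  X * (X * X) ^ t + 1       ≡⟨ cong (λ x → X * x + 1) eq ⟩
  X * (P * suc X + 1) + 1   ≡⟨ solve (X ∷ P ∷ []) ⟩
  (X * P + 1) * suc X       ∎)
  where open ≡-Reasoning

2^[t*2k+j]≡[2^k*2^k]^t*2^j : ∀ k t j → 2 ^ (t * (2 * k) + j) ≡ (2 ^ k * 2 ^ k) ^ t * 2 ^ j
2^[t*2k+j]≡[2^k*2^k]^t*2^j k t j = begin
  2 ^ (t * (2 * k) + j)          ≡⟨ ^-distribˡ-+-* 2 (t * (2 * k)) j ⟩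
  2 ^ (t * (2 * k)) * 2 ^ j      ≡⟨ cong (λ x → 2 ^ x * 2 ^ j) (*-comm t (2 * k)) ⟩
  2 ^ (2 * k * t) * 2 ^ j        ≡⟨ cong (_* 2 ^ j) (^-*-assoc 2 (2 * k) t) ⟨
  (2 ^ (2 * k)) ^ t * 2 ^ j      ≡⟨ cong (λ x → x ^ t * 2 ^ j) 2^[2k]≡2^k*2^k ⟩
  (2 ^ k * 2 ^ k) ^ t * 2 ^ j    ∎
  where
  open ≡-Reasoning
  2^[2k]≡2^k*2^k : 2 ^ (2 * k) ≡ 2 ^ k * 2 ^ k
  2^[2k]≡2^k*2^k = trans (^-distribˡ-+-* 2 k (k + 0)) (cong (λ x → 2 ^ k * 2 ^ x) (+-identityʳ k))

Γ[⌈2^e/1+2^k⌉]⇒Γ[seqA] : ∀ k n {e v} → n + k ≡ suc e →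
                         Γ ⌈ 2 ^ e / 1 + 2 ^ k ⌉ ⌈ 2 * 2 ^ e / 1 + 2 ^ k ⌉ v →
                         Γ (seqA k n) (seqA k (suc n)) v
Γ[⌈2^e/1+2^k⌉]⇒Γ[seqA] k n {v = v} n+k≡1+e = subst₂ (λ a b → Γ a b v)
  (cong (λ x → ⌈ 2 ^ (x ∸ 1) / 1 + 2 ^ k ⌉) (sym n+k≡1+e))
  (cong (λ x → ⌈ 2 ^ x / 1 + 2 ^ k ⌉) (sym n+k≡1+e))

Γ[seqA]≡1 : ∀ k q s → s < k → let n = q * (2 * k) + suc s in Γ (seqA k n) (seqA k (suc n)) 1
Γ[seqA]≡1 k q s s<k = Γ[⌈2^e/1+2^k⌉]⇒Γ[seqA] k (q * (2 * k) + suc s) n+k≡1+e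
  (Γ⌈m/d⌉⌈2m/d⌉≡1 {2 ^ e} 1+X∣2^e+2^s (s≤s (^-monoʳ-≤ 2 s<k)))
  where
  open ≡-Reasoning
  X = 2 ^ k
  e = k + (q * (2 * k) + s)
  n+k≡1+e : q * (2 * k) + suc s + k ≡ suc (k + (q * (2 * k) + s))
  n+k≡1+e = solve (k ∷ q ∷ s ∷ [])
  2^e+2^s≡[X[X*X]^q+1]2^s : 2 ^ e + 2 ^ s ≡ (X * (X * X) ^ q + 1) * 2 ^ s
  2^e+2^s≡[X[X*X]^q+1]2^s = begin
    2 ^ e + 2 ^ s                          ≡⟨ cong (_+ 2 ^ s) (^-distribˡ-+-* 2 k (q * (2 * k) + s)) ⟩
    X * 2 ^ (q * (2 * k) + s) + 2 ^ s      ≡⟨ cong (λ x → X * x + 2 ^ s) (2^[t*2k+j]≡[2^k*2^k]^t*2^j k q s) ⟩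
    X * ((X * X) ^ q * 2 ^ s) + 2 ^ s      ≡⟨ cong₂ _+_ (*-assoc X ((X * X) ^ q) (2 ^ s)) (*-identityˡ (2 ^ s)) ⟨
    X * (X * X) ^ q * 2 ^ s + 1 * 2 ^ s    ≡⟨ *-distribʳ-+ (2 ^ s) (X * (X * X) ^ q) 1 ⟨
    (X * (X * X) ^ q + 1) * 2 ^ s          ∎
  1+X∣2^e+2^s : suc X ∣ 2 ^ e + 2 ^ s
  1+X∣2^e+2^s = subst (suc X ∣_) (sym 2^e+2^s≡[X[X*X]^q+1]2^s)
                  (∣m⇒∣m*n (2 ^ s) (1+X∣X*[X*X]^t+1 q (m^n>0 2 k)))

Γ[seqA]≡2 : ∀ k q j → 1 ≤ k → j < k →
            let n = q * (2 * k) + (suc k + j) in Γ (seqA k n) (seqA k (suc n)) 2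
Γ[seqA]≡2 k q j 1≤k j<k with [X*X]^[1+t]≡[1+P][1+X]+1 q (^-monoʳ-< 2 (s≤s (s≤s z≤n)) 1≤k)
... | P , [X*X]^[1+q]≡[1+P][1+X]+1 = Γ[⌈2^e/1+2^k⌉]⇒Γ[seqA] k (q * (2 * k) + (suc k + j)) n+k≡1+e
  (Γ⌈m/d⌉⌈2m/d⌉≡2 {2 ^ e} 2^e≡[1+P]2^j[1+X]+2^j 1≤[1+P]2^j (m^n>0 2 j)
                           (≤-trans (^-monoʳ-≤ 2 j<k) (n≤1+n X)))
  where
  open ≡-Reasoning
  X = 2 ^ k
  e = suc q * (2 * k) + j
  n+k≡1+e : q * (2 * k) + (suc k + j) + k ≡ suc (suc q * (2 * k) + j)
  n+k≡1+e = solve (k ∷ q ∷ j ∷ [])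
  1≤[1+P]2^j : 1 ≤ suc P * 2 ^ j
  1≤[1+P]2^j = *-mono-≤ {1} {suc P} {1} {2 ^ j} (s≤s z≤n) (m^n>0 2 j)
  2^e≡[1+P]2^j[1+X]+2^j : 2 ^ e ≡ suc P * 2 ^ j * suc X + 2 ^ j
  2^e≡[1+P]2^j[1+X]+2^j = begin
    2 ^ e                                     ≡⟨ 2^[t*2k+j]≡[2^k*2^k]^t*2^j k (suc q) j ⟩
    (X * X) ^ suc q * 2 ^ j                   ≡⟨ cong (_* 2 ^ j) [X*X]^[1+q]≡[1+P][1+X]+1 ⟩
    (suc P * suc X + 1) * 2 ^ j               ≡⟨ *-distribʳ-+ (2 ^ j) (suc P * suc X) 1 ⟩
    suc P * suc X * 2 ^ j + 1 * 2 ^ j         ≡⟨ cong₂ _+_ (*-assoc (suc P) (suc X) (2 ^ j)) (*-identityˡ (2 ^ j)) ⟩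
    suc P * (suc X * 2 ^ j) + 2 ^ j           ≡⟨ cong (λ x → suc P * x + 2 ^ j) (*-comm (suc X) (2 ^ j)) ⟩
    suc P * (2 ^ j * suc X) + 2 ^ j           ≡⟨ cong (_+ 2 ^ j) (*-assoc (suc P) (2 ^ j) (suc X)) ⟨
    suc P * 2 ^ j * suc X + 2 ^ j             ∎

theorem1p2 : (k : ℕ) → 1 ≤ k → (n : ℕ) → 1 ≤ n →
    ((q r : ℕ) → n ≡ q * (2 * k) + r → 1 ≤ r → r ≤ k →
      Γ (seqA k n) (seqA k (suc n)) 1)
    × ((q r : ℕ) → n ≡ q * (2 * k) + r → k < r → r ≤ 2 * k →
      Γ (seqA k n) (seqA k (suc n)) 2)
theorem1p2 k 1≤k n _ = firstHalf , secondHalf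
  where
  firstHalf : (q r : ℕ) → n ≡ q * (2 * k) + r → 1 ≤ r → r ≤ k → Γ (seqA k n) (seqA k (suc n)) 1
  firstHalf q (suc s) refl _ s<k = Γ[seqA]≡1 k q s s<k
  secondHalf : (q r : ℕ) → n ≡ q * (2 * k) + r → k < r → r ≤ 2 * k → Γ (seqA k n) (seqA k (suc n)) 2
  secondHalf q r refl k<r r≤2k with m≤n⇒∃[o]m+o≡n k<r
  ... | j , refl = Γ[seqA]≡2 k q j 1≤k (+-cancelˡ-< k j k k+j<k+k)
    where
    k+j<k+k : k + j < k + k
    k+j<k+k = subst (suc k + j ≤_) (cong (k +_) (+-identityʳ k)) r≤2k
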